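{- For integers $i\ge0$, $j\ge0$ and real $k_1,k_2$, $$\sum_{r=j}^{i}\frac{1}{r!}\,b_{i,r,k_1}\,c_{r,j,k_2}=\binom{i}{j}(k_1-k_2)^{i-j}.$$
   Context: For integers $i\ge0$, $j\ge0$ and real $k$, $b_{i,j,k}=\sum_{r=0}^{j}\binom{j}{r}(-1)^{j-r}(r+k)^i$, with the convention $0^0=1$. The Stirling numbers of the first kind $s_{i,j}$ ($i,j\ge0$) are defined by $s_{0,0}=1$, $s_{0,j}=s_{i,0}=0$ for $i>0,j>0$, and $s_{i+1,j}=s_{i,j-1}-i\,s_{i,j}$. The moment generating Stirling numbers of the first kind are $c_{i,j,k}=\sum_{r=j}^{i}\binom{r}{j}(-k)^{r-j}s_{i,r}$ for integers $i,j\ge0$ and real $k$. Empty sums are $0$ and $\binom{i}{j}=0$ for $j>i$. -}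

module Defs where

open import Level using (Level)
open import Algebra.Bundles using (CommutativeRing)
open import Data.Nat as ℕ using (ℕ; zero; suc; _∸_)
open import Data.Nat.Combinatorics using (_C_)
open import Data.List using (List; foldr; applyUpTo)

-- All notions are defined over an arbitrary commutative ring R
-- (the paper's reals are an instance).
module Notions {c ℓ : Level} (R : CommutativeRing c ℓ) where
  open CommutativeRing R

  fromℕ : ℕ → Carrier
  fromℕ zero    = 0#
  fromℕ (suc n) = 1# + fromℕ n

  -- powers, with x ^ 0 = 1 (so 0^0 = 1)
  infixr 8 _^_
  _^_ : Carrier → ℕ → Carrier
  x ^ zero  = 1#
  x ^ suc n = x * (x ^ n)

  -- Σ_{r=a}^{b} f r  (empty, i.e. 0, when b < a)
  sumFromTo : ℕ → ℕ → (ℕ → Carrier) → Carrier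
  sumFromTo a b f = foldr _+_ 0# (applyUpTo (λ t → f (a ℕ.+ t)) (suc b ∸ a))

  binom : ℕ → ℕ → Carrier
  binom n k = fromℕ (n C k)

  b : ℕ → ℕ → Carrier → Carrier
  b i j k = sumFromTo 0 j (λ r → binom j r * (((- 1#) ^ (j ∸ r)) * ((fromℕ r + k) ^ i)))

  -- Stirling numbers of the first kind (signed), via the recurrence
  s : ℕ → ℕ → Carrier
  s zero    zero    = 1#
  s zero    (suc j) = 0#
  s (suc i) zero    = 0#
  s (suc i) (suc j) = s i j - (fromℕ i * s i (suc j))

  cc : ℕ → ℕ → Carrier → Carrier
  cc i j k = sumFromTo j i (λ r → binom r j * (((- k) ^ (r ∸ j)) * s i r))

-- Write S(i, r) = b_{i,r,k₁} / r! and B_x(l, j) = C(l, j) x^(l-j). The three families S(i, ·), s(r, ·)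
-- and B_x(l, ·) all satisfy a Pascal-type recurrence u_{n+1}(t) = u_n(t - 1) + a(t) u_n(t), with
-- a(t) = t + k₁, -r and x respectively; for S this is the recurrence of b obtained from
-- b_{i,r+1,k} = b_{i,r,k+1} - b_{i,r,k} (b_{i,r,k} is the r-th forward difference of (t + k)^i at 0).
-- Since c_{r,j,k} = Σ_l s(r, l) B_{-k}(l, j), the recurrences of s and B give c_{r+1,j} = c_{r,j-1} - (r + k) c_{r,j},
-- and then the left-hand side T(i, j) satisfies T(i + 1, j) = T(i, j - 1) + (k₁ - k₂) T(i, j) with
-- T(0, j) = [j = 0], which is the recurrence of B_{k₁-k₂}(i, j).

module Submission where

open import Defs
open import Level using (Level)
open import Algebra.Bundles using (CommutativeRing)
open import Data.Nat as ℕ using (ℕ; zero; suc; _∸_; _!; _<_; z≤n; s≤s)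
import Data.Nat.Properties as ℕₚ
open import Data.Nat.Combinatorics using (_C_; k>n⇒nCk≡0; nCk+nC[k+1]≡[n+1]C[k+1])
open import Data.Integer as ℤ using (ℤ; +_; -[1+_]; _⊖_)
import Data.Integer.Properties as ℤₚ
import Data.Sign as Sign
open import Data.List using (foldr; applyUpTo)
open import Data.Maybe as Maybe using (Maybe)
open import Function using (_∘_)
open import Relation.Nullary using (yes; no)
open import Relation.Nullary.Decidable using (dec⇒maybe)
import Relation.Binary.PropositionalEquality as ≡
open ≡ using (_≡_; cong)
import Algebra.Solver.Ring.AlmostCommutativeRing as ACR

-- The ring solver over an arbitrary commutative ring, with integer coefficients: coefficients taken in
-- the ring itself would not let it detect cancellations such as x - x = 0.
module IntegerCoefficients {c ℓ : Level} (R : CommutativeRing c ℓ) where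
  open CommutativeRing R
  open Notions R using (fromℕ)
  open import Algebra.Properties.Ring ring using (-0#≈0#; -‿distribˡ-*; -‿distribʳ-*; -‿involutive; -‿+-comm)
  open import Algebra.Properties.CommutativeSemigroup +-commutativeSemigroup using (interchange)
  open import Algebra.Properties.Semiring.Mult semiring using (_×_; ×-homo-+; ×1-homo-*)
  open import Relation.Binary.Reasoning.Setoid setoid

  fromℕ≡×1# : ∀ n → fromℕ n ≡ n × 1#
  fromℕ≡×1# zero    = ≡.refl
  fromℕ≡×1# (suc n) = cong (λ x → 1# + x) (fromℕ≡×1# n)

  fromℕ-+ : ∀ m n → fromℕ (m ℕ.+ n) ≈ fromℕ m + fromℕ n
  fromℕ-+ m n rewrite fromℕ≡×1# m | fromℕ≡×1# n | fromℕ≡×1# (m ℕ.+ n) = ×-homo-+ 1# m n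

  fromℕ-* : ∀ m n → fromℕ (m ℕ.* n) ≈ fromℕ m * fromℕ n
  fromℕ-* m n rewrite fromℕ≡×1# m | fromℕ≡×1# n | fromℕ≡×1# (m ℕ.* n) = ×1-homo-* m n

  fromℤ : ℤ → Carrier
  fromℤ (+ n)      = fromℕ n
  fromℤ -[1+ n ]   = - fromℕ (suc n)

  ⊖-homo : ∀ m n → fromℤ (m ⊖ n) ≈ fromℕ m - fromℕ n
  ⊖-homo m zero = begin
    fromℤ (m ⊖ 0)  ≡⟨ cong fromℤ (ℤₚ.⊖-≥ {m} z≤n) ⟩
    fromℕ m        ≈⟨ +-identityʳ _ ⟨
    fromℕ m + 0#   ≈⟨ +-congˡ -0#≈0# ⟨
    fromℕ m - 0#   ∎
  ⊖-homo zero (suc n) = begin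
    fromℤ (0 ⊖ suc n)   ≡⟨ cong fromℤ (ℤₚ.⊖-< {0} {suc n} (s≤s z≤n)) ⟩
    - fromℕ (suc n)     ≈⟨ +-identityˡ _ ⟨
    0# - fromℕ (suc n)  ∎
  ⊖-homo (suc m) (suc n) = begin
    fromℤ (suc m ⊖ suc n)               ≡⟨ cong fromℤ (ℤₚ.[1+m]⊖[1+n]≡m⊖n m n) ⟩
    fromℤ (m ⊖ n)                       ≈⟨ ⊖-homo m n ⟩
    fromℕ m - fromℕ n                   ≈⟨ +-identityˡ _ ⟨
    0# + (fromℕ m - fromℕ n)            ≈⟨ +-congʳ (-‿inverseʳ 1#) ⟨
    (1# - 1#) + (fromℕ m - fromℕ n)     ≈⟨ interchange _ _ _ _ ⟩
    (1# + fromℕ m) + (- 1# - fromℕ n)   ≈⟨ +-congˡ (-‿+-comm _ _) ⟩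
    (1# + fromℕ m) - (1# + fromℕ n)     ∎

  +-homo : ∀ x y → fromℤ (x ℤ.+ y) ≈ fromℤ x + fromℤ y
  +-homo (+ m)    (+ n)    = fromℕ-+ m n
  +-homo (+ m)    -[1+ n ] = ⊖-homo m (suc n)
  +-homo -[1+ m ] (+ n)    = trans (⊖-homo n (suc m)) (+-comm _ _)
  +-homo -[1+ m ] -[1+ n ] = begin
    - fromℕ (suc (suc (m ℕ.+ n)))        ≡⟨ cong (λ k → - fromℕ (suc k)) (ℕₚ.+-suc m n) ⟨
    - fromℕ (suc m ℕ.+ suc n)            ≈⟨ -‿cong (fromℕ-+ (suc m) (suc n)) ⟩
    - (fromℕ (suc m) + fromℕ (suc n))    ≈⟨ -‿+-comm _ _ ⟨
    - fromℕ (suc m) - fromℕ (suc n)      ∎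

  -‿homo : ∀ x → fromℤ (ℤ.- x) ≈ - fromℤ x
  -‿homo (+ zero)  = sym -0#≈0#
  -‿homo (+ suc n) = refl
  -‿homo -[1+ n ]  = sym (-‿involutive _)

  +◃-homo : ∀ n → fromℤ (Sign.+ ℤ.◃ n) ≈ fromℕ n
  +◃-homo zero    = refl
  +◃-homo (suc n) = refl

  -◃-homo : ∀ n → fromℤ (Sign.- ℤ.◃ n) ≈ - fromℕ n
  -◃-homo zero    = sym -0#≈0#
  -◃-homo (suc n) = refl

  -x*-y≈x*y : ∀ x y → - x * - y ≈ x * y
  -x*-y≈x*y x y = begin
    - x * - y     ≈⟨ -‿distribˡ-* x (- y) ⟨
    - (x * - y)   ≈⟨ -‿cong (-‿distribʳ-* x y) ⟨
    - - (x * y)   ≈⟨ -‿involutive _ ⟩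
    x * y         ∎

  *-homo : ∀ x y → fromℤ (x ℤ.* y) ≈ fromℤ x * fromℤ y
  *-homo (+ m)    (+ n)    = trans (+◃-homo (m ℕ.* n)) (fromℕ-* m n)
  *-homo (+ m)    -[1+ n ] = trans (-◃-homo (m ℕ.* suc n)) (trans (-‿cong (fromℕ-* m (suc n))) (-‿distribʳ-* _ _))
  *-homo -[1+ m ] (+ n)    = trans (-◃-homo (suc m ℕ.* n)) (trans (-‿cong (fromℕ-* (suc m) n)) (-‿distribˡ-* _ _))
  *-homo -[1+ m ] -[1+ n ] = trans (+◃-homo (suc m ℕ.* suc n)) (trans (fromℕ-* (suc m) (suc n)) (sym (-x*-y≈x*y _ _)))

  homomorphism : ℤ.+-*-rawRing ACR.-Raw-AlmostCommutative⟶ ACR.fromCommutativeRing R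
  homomorphism = record
    { ⟦_⟧ = fromℤ ; +-homo = +-homo ; *-homo = *-homo ; -‿homo = -‿homo
    ; 0-homo = refl ; 1-homo = +-identityʳ 1# }

  fromℤ-equal? : ∀ x y → Maybe (fromℤ x ≈ fromℤ y)
  fromℤ-equal? x y = Maybe.map (reflexive ∘ cong fromℤ) (dec⇒maybe (x ℤₚ.≟ y))

  open import Algebra.Solver.Ring ℤ.+-*-rawRing (ACR.fromCommutativeRing R) homomorphism fromℤ-equal?
    public using (solve; _:=_; _:+_; _:*_; _:-_; :-_; con)

module Development {c ℓ : Level} (R : CommutativeRing c ℓ) where
  open CommutativeRing R
  open Notions R
  open IntegerCoefficients R using (fromℕ-+; fromℕ-*; solve; _:=_; _:+_; _:*_; _:-_; :-_; con)
  open import Algebra.Properties.Ring ring using (-0#≈0#; -1*x≈-x; -‿distribˡ-*; -‿+-comm; x[y-z]≈xy-xz)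
  open import Algebra.Properties.CommutativeSemigroup +-commutativeSemigroup using (interchange)
  open import Algebra.Properties.CommutativeSemigroup *-commutativeSemigroup using (x∙yz≈y∙xz)
  open import Relation.Binary.Reasoning.Setoid setoid

  ^-congˡ : ∀ {x y} n → x ≈ y → x ^ n ≈ y ^ n
  ^-congˡ zero    x≈y = refl
  ^-congˡ (suc n) x≈y = *-cong x≈y (^-congˡ n x≈y)

  -- ∑ n f = f 0 + ⋯ + f (n - 1), defined so that sumFromTo a b f is ∑ (suc b ∸ a) (λ t → f (a + t)).
  ∑ : ℕ → (ℕ → Carrier) → Carrier
  ∑ n f = foldr _+_ 0# (applyUpTo f n)

  ∑-cong : ∀ n {f g} → (∀ t → f t ≈ g t) → ∑ n f ≈ ∑ n g
  ∑-cong zero    f≈g = refl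
  ∑-cong (suc n) f≈g = +-cong (f≈g 0) (∑-cong n (f≈g ∘ suc))

  ∑-vanishing : ∀ n {f} → (∀ t → t < n → f t ≈ 0#) → ∑ n f ≈ 0#
  ∑-vanishing zero    f≈0 = refl
  ∑-vanishing (suc n) f≈0 =
    trans (+-cong (f≈0 0 (s≤s z≤n)) (∑-vanishing n (λ t t<n → f≈0 (suc t) (s≤s t<n)))) (+-identityʳ 0#)

  ∑-+ : ∀ n f g → ∑ n (λ t → f t + g t) ≈ ∑ n f + ∑ n g
  ∑-+ zero    f g = sym (+-identityʳ 0#)
  ∑-+ (suc n) f g = trans (+-congˡ (∑-+ n (f ∘ suc) (g ∘ suc))) (interchange _ _ _ _)

  ∑-*ˡ : ∀ n x f → ∑ n (λ t → x * f t) ≈ x * ∑ n f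
  ∑-*ˡ zero    x f = sym (zeroʳ x)
  ∑-*ˡ (suc n) x f = trans (+-congˡ (∑-*ˡ n x (f ∘ suc))) (sym (distribˡ x _ _))

  ∑-neg : ∀ n f → ∑ n (λ t → - f t) ≈ - ∑ n f
  ∑-neg zero    f = sym -0#≈0#
  ∑-neg (suc n) f = trans (+-congˡ (∑-neg n (f ∘ suc))) (-‿+-comm _ _)

  ∑-sub : ∀ n f g → ∑ n (λ t → f t - g t) ≈ ∑ n f - ∑ n g
  ∑-sub n f g = trans (∑-+ n f (λ t → - g t)) (+-congˡ (∑-neg n g))

  ∑-dropLast : ∀ n f → f n ≈ 0# → ∑ (suc n) f ≈ ∑ n f
  ∑-dropLast zero    f fn≈0 = trans (+-identityʳ _) fn≈0
  ∑-dropLast (suc n) f fn≈0 = +-congˡ (∑-dropLast n (f ∘ suc) fn≈0)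

  ∑-dropInitial : ∀ a n f → (∀ t → t < a → f t ≈ 0#) → ∑ (a ℕ.+ n) f ≈ ∑ n (λ t → f (a ℕ.+ t))
  ∑-dropInitial zero    n f f≈0 = refl
  ∑-dropInitial (suc a) n f f≈0 = begin
    f 0 + ∑ (a ℕ.+ n) (f ∘ suc)
      ≈⟨ +-cong (f≈0 0 (s≤s z≤n)) (∑-dropInitial a n (f ∘ suc) (λ t t<a → f≈0 (suc t) (s≤s t<a))) ⟩
    0# + ∑ n (λ t → f (suc a ℕ.+ t))
      ≈⟨ +-identityˡ _ ⟩
    ∑ n (λ t → f (suc a ℕ.+ t))
      ∎

  sumFromTo-vanishingBelow : ∀ a b f → (∀ t → t < a → f t ≈ 0#) → sumFromTo a b f ≈ ∑ (suc b) f
  sumFromTo-vanishingBelow a b f f≈0 with a ℕ.≤? suc b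
  ... | yes a≤1+b = sym (begin
    ∑ (suc b) f                   ≡⟨ cong (λ n → ∑ n f) (ℕₚ.m+[n∸m]≡n a≤1+b) ⟨
    ∑ (a ℕ.+ (suc b ∸ a)) f       ≈⟨ ∑-dropInitial a (suc b ∸ a) f f≈0 ⟩
    sumFromTo a b f               ∎)
  ... | no a≰1+b = begin
    sumFromTo a b f               ≡⟨ cong (λ n → ∑ n (λ t → f (a ℕ.+ t))) (ℕₚ.m≤n⇒m∸n≡0 1+b≤a) ⟩
    0#                            ≈⟨ ∑-vanishing (suc b) (λ t t<1+b → f≈0 t (ℕₚ.<-≤-trans t<1+b 1+b≤a)) ⟨
    ∑ (suc b) f                   ∎
    where 1+b≤a = ℕₚ.≰⇒≥ a≰1+b

  prev : (ℕ → Carrier) → ℕ → Carrier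
  prev f zero    = 0#
  prev f (suc n) = f n

  prev-cong : ∀ {f g} → (∀ n → f n ≈ g n) → ∀ n → prev f n ≈ prev g n
  prev-cong f≈g zero    = refl
  prev-cong f≈g (suc n) = f≈g n

  weightedSum : ℕ → (ℕ → Carrier) → (ℕ → Carrier) → Carrier
  weightedSum n w f = ∑ n (λ t → w t * f t)

  weightedSum-congʳ : ∀ n w {f g} → (∀ t → f t ≈ g t) → weightedSum n w f ≈ weightedSum n w g
  weightedSum-congʳ n w f≈g = ∑-cong n (λ t → *-congˡ (f≈g t))

  weightedSum-*ˡ : ∀ n w x f → weightedSum n w (λ t → x * f t) ≈ x * weightedSum n w f
  weightedSum-*ˡ n w x f = trans (∑-cong n (λ t → x∙yz≈y∙xz (w t) x (f t))) (∑-*ˡ n x (λ t → w t * f t))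

  weightedSum-+ʳ : ∀ n w f g → weightedSum n w (λ t → f t + g t) ≈ weightedSum n w f + weightedSum n w g
  weightedSum-+ʳ n w f g = trans (∑-cong n (λ t → distribˡ (w t) (f t) (g t))) (∑-+ n _ _)

  weightedSum-subʳ : ∀ n w f g → weightedSum n w (λ t → f t - g t) ≈ weightedSum n w f - weightedSum n w g
  weightedSum-subʳ n w f g = trans (∑-cong n (λ t → x[y-z]≈xy-xz (w t) (f t) (g t))) (∑-sub n _ _)

  weightedSum-difference : ∀ n w (a : ℕ → Carrier) x y f →
    weightedSum n w (λ t → (a t + x) * f t) - weightedSum n w (λ t → (a t + y) * f t) ≈ (x - y) * weightedSum n w f
  weightedSum-difference n w a x y f = begin
    weightedSum n w (λ t → (a t + x) * f t) - weightedSum n w (λ t → (a t + y) * f t)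
      ≈⟨ weightedSum-subʳ n w (λ t → (a t + x) * f t) (λ t → (a t + y) * f t) ⟨
    weightedSum n w (λ t → (a t + x) * f t - (a t + y) * f t)
      ≈⟨ weightedSum-congʳ n w (λ t → solve 4 (λ a x y f → (a :+ x) :* f :- (a :+ y) :* f := (x :- y) :* f)
                                              refl (a t) x y (f t)) ⟩
    weightedSum n w (λ t → (x - y) * f t)
      ≈⟨ weightedSum-*ˡ n w (x - y) f ⟩
    (x - y) * weightedSum n w f
      ∎

  weightedSum-prev : ∀ n w f → weightedSum (suc n) (prev w) f ≈ weightedSum n w (f ∘ suc)
  weightedSum-prev n w f = trans (+-congʳ (zeroˡ (f 0))) (+-identityˡ _)

  weightedSum-prevʳ : ∀ n w (f : ℕ → ℕ → Carrier) j →
    weightedSum n w (λ t → prev (f t) j) ≈ prev (λ j → weightedSum n w (λ t → f t j)) j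
  weightedSum-prevʳ n w f zero    = ∑-vanishing n (λ t _ → zeroʳ (w t))
  weightedSum-prevʳ n w f (suc j) = refl

  weightedSum-recurrence : ∀ N (a : ℕ → Carrier) {w w′ : ℕ → Carrier} →
    (∀ t → w′ t ≈ prev w t + a t * w t) → w N ≈ 0# → ∀ f →
    weightedSum (suc N) w′ f ≈ weightedSum N w (f ∘ suc) + weightedSum N w (λ t → a t * f t)
  weightedSum-recurrence N a {w} {w′} w′≈ wN≈0 f = begin
    weightedSum (suc N) w′ f
      ≈⟨ ∑-cong (suc N) (λ t → trans (*-congʳ (w′≈ t))
           (solve 4 (λ p a w f → (p :+ a :* w) :* f := p :* f :+ w :* (a :* f))
                    refl (prev w t) (a t) (w t) (f t))) ⟩
    ∑ (suc N) (λ t → prev w t * f t + w t * (a t * f t))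
      ≈⟨ ∑-+ (suc N) (λ t → prev w t * f t) (λ t → w t * (a t * f t)) ⟩
    weightedSum (suc N) (prev w) f + weightedSum (suc N) w (λ t → a t * f t)
      ≈⟨ +-cong (weightedSum-prev N w f) (∑-dropLast N (λ t → w t * (a t * f t)) (trans (*-congʳ wN≈0) (zeroˡ _))) ⟩
    weightedSum N w (f ∘ suc) + weightedSum N w (λ t → a t * f t) ∎

  binom-vanishing : ∀ {l j} → l < j → binom l j ≈ 0#
  binom-vanishing l<j = reflexive (cong fromℕ (k>n⇒nCk≡0 l<j))

  binom-pascal : ∀ l j → binom (suc l) (suc j) ≈ binom l j + binom l (suc j)
  binom-pascal l j = trans (reflexive (cong fromℕ (≡.sym (nCk+nC[k+1]≡[n+1]C[k+1] l j)))) (fromℕ-+ (l C j) (l C suc j))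

  -- binomTerm x l j = C(l, j) x^(l-j) is the coefficient of y^j in (x + y)^l.
  binomTerm : Carrier → ℕ → ℕ → Carrier
  binomTerm x l j = binom l j * x ^ (l ∸ j)

  binomTerm-vanishing : ∀ x {l j} → l < j → binomTerm x l j ≈ 0#
  binomTerm-vanishing x l<j = trans (*-congʳ (binom-vanishing l<j)) (zeroˡ _)

  binom-shift : ∀ x l j → binom l (suc j) * x ^ (l ∸ j) ≈ x * binomTerm x l (suc j)
  binom-shift x l j with j ℕ.<? l
  ... | yes j<l = begin
    binom l (suc j) * x ^ (l ∸ j)              ≡⟨ cong (λ n → binom l (suc j) * x ^ n) (ℕₚ.+-∸-assoc 1 j<l) ⟩
    binom l (suc j) * (x * x ^ (l ∸ suc j))    ≈⟨ x∙yz≈y∙xz _ _ _ ⟩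
    x * binomTerm x l (suc j)                  ∎
  ... | no j≮l = begin
    binom l (suc j) * x ^ (l ∸ j)              ≈⟨ trans (*-congʳ (binom-vanishing l<1+j)) (zeroˡ _) ⟩
    0#                                         ≈⟨ zeroʳ x ⟨
    x * 0#                                     ≈⟨ *-congˡ (binomTerm-vanishing x l<1+j) ⟨
    x * binomTerm x l (suc j)                  ∎
    where l<1+j = s≤s (ℕₚ.≮⇒≥ j≮l)

  binomTerm-suc : ∀ x l j → binomTerm x (suc l) j ≈ prev (binomTerm x l) j + x * binomTerm x l j
  binomTerm-suc x l zero =
    -- binom (suc l) 0 and binom l 0 both compute to 1# + 0#.
    solve 3 (λ b x y → b :* (x :* y) := con (+ 0) :+ x :* (b :* y)) refl (binom l 0) x (x ^ l)
  binomTerm-suc x l (suc j) = begin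
    binom (suc l) (suc j) * x ^ (l ∸ j)                 ≈⟨ *-congʳ (binom-pascal l j) ⟩
    (binom l j + binom l (suc j)) * x ^ (l ∸ j)         ≈⟨ distribʳ _ _ _ ⟩
    binomTerm x l j + binom l (suc j) * x ^ (l ∸ j)     ≈⟨ +-congˡ (binom-shift x l j) ⟩
    binomTerm x l j + x * binomTerm x l (suc j)         ∎

  binomTerm-zero : ∀ x y j → binomTerm x 0 j ≡ binomTerm y 0 j
  binomTerm-zero x y zero    = ≡.refl
  binomTerm-zero x y (suc j) = ≡.refl

  weightedSum-binomTerm-suc : ∀ x l f →
    weightedSum (suc (suc l)) (binomTerm x (suc l)) f ≈
    weightedSum (suc l) (binomTerm x l) (f ∘ suc) + x * weightedSum (suc l) (binomTerm x l) f
  weightedSum-binomTerm-suc x l f =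
    trans (weightedSum-recurrence (suc l) (λ _ → x) (binomTerm-suc x l) (binomTerm-vanishing x (ℕₚ.n<1+n l)) f)
          (+-congˡ (weightedSum-*ˡ (suc l) (binomTerm x l) x f))

  b-as-weightedSum : ∀ i r k → b i r k ≈ weightedSum (suc r) (binomTerm (- 1#) r) (λ t → (fromℕ t + k) ^ i)
  b-as-weightedSum i r k = ∑-cong (suc r) (λ t → sym (*-assoc (binom r t) ((- 1#) ^ (r ∸ t)) ((fromℕ t + k) ^ i)))

  b-zero : ∀ i k → b i 0 k ≈ k ^ i
  b-zero i k = begin
    (1# + 0#) * (1# * (0# + k) ^ i) + 0#  ≈⟨ +-identityʳ _ ⟩
    (1# + 0#) * (1# * (0# + k) ^ i)       ≈⟨ *-cong (+-identityʳ 1#) (*-identityˡ _) ⟩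
    1# * (0# + k) ^ i                     ≈⟨ *-identityˡ _ ⟩
    (0# + k) ^ i                          ≈⟨ ^-congˡ i (+-identityˡ k) ⟩
    k ^ i                                 ∎

  b-difference : ∀ i r k → b i (suc r) k ≈ b i r (1# + k) - b i r k
  b-difference i r k = begin
    b i (suc r) k
      ≈⟨ b-as-weightedSum i (suc r) k ⟩
    weightedSum (suc (suc r)) (binomTerm (- 1#) (suc r)) (power k)
      ≈⟨ weightedSum-binomTerm-suc (- 1#) r (power k) ⟩
    Δ (power k ∘ suc) + - 1# * Δ (power k)
      ≈⟨ +-cong (weightedSum-congʳ (suc r) (binomTerm (- 1#) r) (λ t → ^-congˡ i (moveOne t))) (-1*x≈-x _) ⟩
    Δ (power (1# + k)) - Δ (power k)
      ≈⟨ +-cong (b-as-weightedSum i r (1# + k)) (-‿cong (b-as-weightedSum i r k)) ⟨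
    b i r (1# + k) - b i r k
      ∎
    where
    power : Carrier → ℕ → Carrier
    power k t = (fromℕ t + k) ^ i
    Δ : (ℕ → Carrier) → Carrier
    Δ = weightedSum (suc r) (binomTerm (- 1#) r)
    moveOne : ∀ t → (1# + fromℕ t) + k ≈ fromℕ t + (1# + k)
    moveOne t = solve 3 (λ o n k → (o :+ n) :+ k := n :+ (o :+ k)) refl 1# (fromℕ t) k

  b-suc : ∀ i r k → b (suc i) (suc r) k ≈ (fromℕ (suc r) + k) * b i (suc r) k + fromℕ (suc r) * b i r k
  b-suc i zero k = begin
    b (suc i) 1 k                              ≈⟨ b-difference (suc i) 0 k ⟩
    b (suc i) 0 (1# + k) - b (suc i) 0 k       ≈⟨ +-cong (b-zero (suc i) (1# + k)) (-‿cong (b-zero (suc i) k)) ⟩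
    (1# + k) * X - k * Y
      ≈⟨ solve 4 (λ o k X Y → (o :+ k) :* X :- k :* Y := ((o :+ con (+ 0)) :+ k) :* (X :- Y) :+ (o :+ con (+ 0)) :* Y)
               refl 1# k X Y ⟩
    (fromℕ 1 + k) * (X - Y) + fromℕ 1 * Y      ≈⟨ +-cong (*-congˡ b-i-1) (*-congˡ (b-zero i k)) ⟨
    (fromℕ 1 + k) * b i 1 k + fromℕ 1 * b i 0 k ∎
    where
    X = (1# + k) ^ i
    Y = k ^ i
    b-i-1 : b i 1 k ≈ X - Y
    b-i-1 = trans (b-difference i 0 k) (+-cong (b-zero i (1# + k)) (-‿cong (b-zero i k)))
  b-suc i (suc r) k = begin
    b (suc i) (suc (suc r)) k
      ≈⟨ b-difference (suc i) (suc r) k ⟩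
    b (suc i) (suc r) (1# + k) - b (suc i) (suc r) k
      ≈⟨ +-cong (b-suc i r (1# + k)) (-‿cong (b-suc i r k)) ⟩
    ((F + (1# + k)) * A + F * U) - ((F + k) * B + F * V)
      ≈⟨ solve 7 (λ o F k A B U V → ((F :+ (o :+ k)) :* A :+ F :* U) :- ((F :+ k) :* B :+ F :* V)
                   := ((o :+ F) :+ k) :* (A :- B) :+ (o :+ F) :* B :+ F :* (U :- V) :- F :* B) refl 1# F k A B U V ⟩
    ((1# + F) + k) * (A - B) + (1# + F) * B + F * (U - V) - F * B
      ≈⟨ +-congʳ (+-congˡ (*-congˡ (b-difference i r k))) ⟨
    ((1# + F) + k) * (A - B) + (1# + F) * B + F * B - F * B
      ≈⟨ solve 2 (λ X Y → X :+ Y :- Y := X) refl _ (F * B) ⟩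
    ((1# + F) + k) * (A - B) + (1# + F) * B
      ≈⟨ +-congʳ (*-congˡ (b-difference i (suc r) k)) ⟨
    (fromℕ (suc (suc r)) + k) * b i (suc (suc r)) k + fromℕ (suc (suc r)) * b i (suc r) k
      ∎
    where
    F = fromℕ (suc r)
    A = b i (suc r) (1# + k)
    B = b i (suc r) k
    U = b i r (1# + k)
    V = b i r k

  b-vanishing : ∀ {i r} k → i < r → b i r k ≈ 0#
  b-vanishing {zero}  {suc r} k _          = trans (b-difference 0 r k) (-‿inverseʳ _)
  b-vanishing {suc i} {suc r} k (s≤s i<r) = begin
    b (suc i) (suc r) k                                      ≈⟨ b-suc i r k ⟩
    (fromℕ (suc r) + k) * b i (suc r) k + fromℕ (suc r) * b i r k
      ≈⟨ +-cong (*-congˡ (b-vanishing k (ℕₚ.m<n⇒m<1+n i<r))) (*-congˡ (b-vanishing k i<r)) ⟩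
    (fromℕ (suc r) + k) * 0# + fromℕ (suc r) * 0#           ≈⟨ +-cong (zeroʳ _) (zeroʳ _) ⟩
    0# + 0#                                                  ≈⟨ +-identityʳ 0# ⟩
    0#                                                       ∎

  s-vanishing : ∀ {r l} → r < l → s r l ≈ 0#
  s-vanishing {zero}  {suc l} _          = refl
  s-vanishing {suc r} {suc l} (s≤s r<l) = begin
    s r l - fromℕ r * s r (suc l)
      ≈⟨ +-cong (s-vanishing r<l) (-‿cong (trans (*-congˡ (s-vanishing (ℕₚ.m<n⇒m<1+n r<l))) (zeroʳ _))) ⟩
    0# - 0#                        ≈⟨ -‿inverseʳ 0# ⟩
    0#                             ∎

  s-suc : ∀ r l → s (suc r) l ≈ prev (s r) l + - fromℕ r * s r l
  s-suc r       (suc l) = +-congˡ (-‿distribˡ-* _ _)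
  s-suc r       zero    = sym (begin
    0# + - fromℕ r * s r 0   ≈⟨ +-identityˡ _ ⟩
    - fromℕ r * s r 0        ≈⟨ -‿distribˡ-* _ _ ⟨
    - (fromℕ r * s r 0)      ≈⟨ -‿cong (r*s[r,0]≈0 r) ⟩
    - 0#                     ≈⟨ -0#≈0# ⟩
    0#                       ∎)
    where
    r*s[r,0]≈0 : ∀ r → fromℕ r * s r 0 ≈ 0#
    r*s[r,0]≈0 zero    = zeroˡ _
    r*s[r,0]≈0 (suc r) = zeroʳ _

  weightedSum-s-suc : ∀ r f →
    weightedSum (suc (suc r)) (s (suc r)) f ≈
    weightedSum (suc r) (s r) (f ∘ suc) - fromℕ r * weightedSum (suc r) (s r) f
  weightedSum-s-suc r f =
    trans (weightedSum-recurrence (suc r) (λ _ → - fromℕ r) (s-suc r) (s-vanishing (ℕₚ.n<1+n r)) f)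
          (+-congˡ (trans (weightedSum-*ˡ (suc r) (s r) (- fromℕ r) f) (sym (-‿distribˡ-* _ _))))

  cc-as-weightedSum : ∀ r j k → cc r j k ≈ weightedSum (suc r) (s r) (λ l → binomTerm (- k) l j)
  cc-as-weightedSum r j k =
    trans (sumFromTo-vanishingBelow j r (λ l → binom l j * ((- k) ^ (l ∸ j) * s r l))
                                    (λ l l<j → trans (*-congʳ (binom-vanishing l<j)) (zeroˡ _)))
          (∑-cong (suc r) (λ l → solve 3 (λ c p t → c :* (p :* t) := t :* (c :* p))
                                          refl (binom l j) ((- k) ^ (l ∸ j)) (s r l)))

  cc-vanishing : ∀ k {r j} → r < j → cc r j k ≈ 0#
  cc-vanishing k {r} {j} r<j = trans (cc-as-weightedSum r j k)
    (∑-vanishing (suc r) (λ l l≤r →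
      trans (*-congˡ (binomTerm-vanishing (- k) (ℕₚ.<-≤-trans l≤r r<j))) (zeroʳ (s r l))))

  cc-zero : ∀ k x j → cc 0 j k ≈ binomTerm x 0 j
  cc-zero k x j = begin
    cc 0 j k                            ≈⟨ cc-as-weightedSum 0 j k ⟩
    1# * binomTerm (- k) 0 j + 0#       ≈⟨ trans (+-identityʳ _) (*-identityˡ _) ⟩
    binomTerm (- k) 0 j                 ≡⟨ binomTerm-zero (- k) x j ⟩
    binomTerm x 0 j                     ∎

  cc-suc : ∀ r j k → cc (suc r) j k ≈ prev (λ j → cc r j k) j - (fromℕ r + k) * cc r j k
  cc-suc r j k = begin
    cc (suc r) j k
      ≈⟨ cc-as-weightedSum (suc r) j k ⟩
    weightedSum (suc (suc r)) (s (suc r)) (B j)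
      ≈⟨ weightedSum-s-suc r (B j) ⟩
    weightedSum (suc r) (s r) (B j ∘ suc) - fromℕ r * W j
      ≈⟨ +-congʳ (weightedSum-congʳ (suc r) (s r) (λ l → binomTerm-suc (- k) l j)) ⟩
    weightedSum (suc r) (s r) (λ l → prev (λ j → B j l) j + - k * B j l) - fromℕ r * W j
      ≈⟨ +-congʳ (trans (weightedSum-+ʳ (suc r) (s r) (λ l → prev (λ j → B j l) j) (λ l → - k * B j l))
                        (+-congˡ (weightedSum-*ˡ (suc r) (s r) (- k) (B j)))) ⟩
    (weightedSum (suc r) (s r) (λ l → prev (λ j → B j l) j) + - k * W j) - fromℕ r * W j
      ≈⟨ +-congʳ (+-congʳ (weightedSum-prevʳ (suc r) (s r) (λ l j → B j l) j)) ⟩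
    (prev W j + - k * W j) - fromℕ r * W j
      ≈⟨ solve 4 (λ p k w n → (p :+ (:- k) :* w) :- n :* w := p :- (n :+ k) :* w) refl (prev W j) k (W j) (fromℕ r) ⟩
    prev W j - (fromℕ r + k) * W j
      ≈⟨ +-cong (prev-cong (λ j → cc-as-weightedSum r j k) j) (-‿cong (*-congˡ (cc-as-weightedSum r j k))) ⟨
    prev (λ j → cc r j k) j - (fromℕ r + k) * cc r j k
      ∎
    where
    B : ℕ → ℕ → Carrier
    B j l = binomTerm (- k) l j
    W : ℕ → Carrier
    W j = weightedSum (suc r) (s r) (B j)

  module _ (inv : ℕ → Carrier) (inv-! : ∀ n → fromℕ (n !) * inv n ≈ 1#) where

    inv-suc : ∀ r → inv (suc r) * fromℕ (suc r) ≈ inv r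
    inv-suc r = begin
      inv (suc r) * fromℕ (suc r)                                ≈⟨ *-identityʳ _ ⟨
      inv (suc r) * fromℕ (suc r) * 1#                           ≈⟨ *-congˡ (inv-! r) ⟨
      inv (suc r) * fromℕ (suc r) * (fromℕ (r !) * inv r)
        ≈⟨ solve 4 (λ v n f u → v :* n :* (f :* u) := (n :* f) :* v :* u)
                 refl (inv (suc r)) (fromℕ (suc r)) (fromℕ (r !)) (inv r) ⟩
      fromℕ (suc r) * fromℕ (r !) * inv (suc r) * inv r          ≈⟨ *-congʳ (*-congʳ (fromℕ-* (suc r) (r !))) ⟨
      fromℕ (suc r !) * inv (suc r) * inv r                      ≈⟨ *-congʳ (inv-! (suc r)) ⟩
      1# * inv r                                                 ≈⟨ *-identityˡ _ ⟩
      inv r                                                      ∎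

    -- stirling₂ k i r = b_{i,r,k} / r!; for k = 0 these are the Stirling numbers of the second kind.
    stirling₂ : Carrier → ℕ → ℕ → Carrier
    stirling₂ k i r = inv r * b i r k

    stirling₂-zero : ∀ k → stirling₂ k 0 0 ≈ 1#
    stirling₂-zero k = begin
      inv 0 * b 0 0 k       ≈⟨ *-congˡ (b-zero 0 k) ⟩
      inv 0 * 1#            ≈⟨ *-identityʳ _ ⟩
      inv 0                 ≈⟨ *-identityˡ _ ⟨
      1# * inv 0            ≈⟨ *-congʳ (+-identityʳ 1#) ⟨
      fromℕ (0 !) * inv 0   ≈⟨ inv-! 0 ⟩
      1#                    ∎

    stirling₂-vanishing : ∀ k {i r} → i < r → stirling₂ k i r ≈ 0#
    stirling₂-vanishing k i<r = trans (*-congˡ (b-vanishing k i<r)) (zeroʳ _)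

    stirling₂-suc : ∀ k i r → stirling₂ k (suc i) r ≈ prev (stirling₂ k i) r + (fromℕ r + k) * stirling₂ k i r
    stirling₂-suc k i zero = begin
      inv 0 * b (suc i) 0 k      ≈⟨ *-congˡ (trans (b-zero (suc i) k) (*-congˡ (sym (b-zero i k)))) ⟩
      inv 0 * (k * b i 0 k)      ≈⟨ solve 3 (λ v k x → v :* (k :* x) := con (+ 0) :+ (con (+ 0) :+ k) :* (v :* x))
                                        refl (inv 0) k (b i 0 k) ⟩
      0# + (fromℕ 0 + k) * (inv 0 * b i 0 k) ∎
    stirling₂-suc k i (suc r) = begin
      inv (suc r) * b (suc i) (suc r) k
        ≈⟨ *-congˡ (b-suc i r k) ⟩
      inv (suc r) * ((fromℕ (suc r) + k) * b i (suc r) k + fromℕ (suc r) * b i r k)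
        ≈⟨ solve 5 (λ v n k x y → v :* ((n :+ k) :* x :+ n :* y) := v :* n :* y :+ (n :+ k) :* (v :* x))
             refl (inv (suc r)) (fromℕ (suc r)) k (b i (suc r) k) (b i r k) ⟩
      inv (suc r) * fromℕ (suc r) * b i r k + (fromℕ (suc r) + k) * stirling₂ k i (suc r)
        ≈⟨ +-congʳ (*-congʳ (inv-suc r)) ⟩
      stirling₂ k i r + (fromℕ (suc r) + k) * stirling₂ k i (suc r)
        ∎

    module _ (k₁ k₂ : Carrier) where

      productSum : ℕ → ℕ → ℕ → Carrier
      productSum N i j = weightedSum N (stirling₂ k₁ i) (λ r → cc r j k₂)

      productSum-zero : ∀ N → 0 < N → ∀ j → productSum N 0 j ≈ cc 0 j k₂
      productSum-zero (suc N) _ j = begin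
        stirling₂ k₁ 0 0 * cc 0 j k₂ + weightedSum N (stirling₂ k₁ 0 ∘ suc) (λ r → cc (suc r) j k₂)
          ≈⟨ +-cong (*-congʳ (stirling₂-zero k₁))
                    (∑-vanishing N (λ r _ → trans (*-congʳ (stirling₂-vanishing k₁ (s≤s z≤n))) (zeroˡ _))) ⟩
        1# * cc 0 j k₂ + 0#
          ≈⟨ trans (+-identityʳ _) (*-identityˡ _) ⟩
        cc 0 j k₂ ∎

      productSum-suc : ∀ {N i} → i < N → ∀ j →
        productSum (suc N) (suc i) j ≈ prev (productSum N i) j + (k₁ - k₂) * productSum N i j
      productSum-suc {N} {i} i<N j = begin
        productSum (suc N) (suc i) j
          ≈⟨ weightedSum-recurrence N (λ r → fromℕ r + k₁) (stirling₂-suc k₁ i) (stirling₂-vanishing k₁ i<N) cⱼ ⟩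
        weightedSum N S (cⱼ ∘ suc) + shifted k₁
          ≈⟨ +-congʳ (weightedSum-congʳ N S (λ r → cc-suc r j k₂)) ⟩
        weightedSum N S (λ r → prev (λ j → cc r j k₂) j - (fromℕ r + k₂) * cⱼ r) + shifted k₁
          ≈⟨ +-congʳ (trans (weightedSum-subʳ N S (λ r → prev (λ j → cc r j k₂) j) (λ r → (fromℕ r + k₂) * cⱼ r))
                            (+-congʳ (weightedSum-prevʳ N S (λ r j → cc r j k₂) j))) ⟩
        prev (productSum N i) j - shifted k₂ + shifted k₁
          ≈⟨ solve 3 (λ p y x → p :- y :+ x := p :+ (x :- y)) refl _ _ _ ⟩
        prev (productSum N i) j + (shifted k₁ - shifted k₂)
          ≈⟨ +-congˡ (weightedSum-difference N S fromℕ k₁ k₂ cⱼ) ⟩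
        prev (productSum N i) j + (k₁ - k₂) * productSum N i j
          ∎
        where
        S = stirling₂ k₁ i
        cⱼ : ℕ → Carrier
        cⱼ r = cc r j k₂
        shifted : Carrier → Carrier
        shifted k = weightedSum N S (λ r → (fromℕ r + k) * cⱼ r)

      productSum-binomTerm : ∀ i {N} → i < N → ∀ j → productSum N i j ≈ binomTerm (k₁ - k₂) i j
      productSum-binomTerm zero    {N} 0<N        j = trans (productSum-zero N 0<N j) (cc-zero k₂ (k₁ - k₂) j)
      productSum-binomTerm (suc i) {suc N} (s≤s i<N) j = begin
        productSum (suc N) (suc i) j
          ≈⟨ productSum-suc i<N j ⟩
        prev (productSum N i) j + (k₁ - k₂) * productSum N i j
          ≈⟨ +-cong (prev-cong (productSum-binomTerm i i<N) j) (*-congˡ (productSum-binomTerm i i<N j)) ⟩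
        prev (binomTerm (k₁ - k₂) i) j + (k₁ - k₂) * binomTerm (k₁ - k₂) i j
          ≈⟨ binomTerm-suc (k₁ - k₂) i j ⟨
        binomTerm (k₁ - k₂) (suc i) j
          ∎

mainTheorem17 : {c ℓ : Level} (R : CommutativeRing c ℓ) →
    let open CommutativeRing R in
    let open Notions R in
    (inv : ℕ → Carrier) → (∀ n → fromℕ (n !) * inv n ≈ 1#) →
    ∀ (i j : ℕ) (k₁ k₂ : Carrier) →
    sumFromTo j i (λ r → inv r * (b i r k₁ * cc r j k₂)) ≈ binom i j * ((k₁ - k₂) ^ (i ∸ j))
mainTheorem17 R inv inv-! i j k₁ k₂ = begin
  sumFromTo j i (λ r → inv r * (b i r k₁ * cc r j k₂))
    ≈⟨ sumFromTo-vanishingBelow j i (λ r → inv r * (b i r k₁ * cc r j k₂)) below-j ⟩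
  ∑ (suc i) (λ r → inv r * (b i r k₁ * cc r j k₂))
    ≈⟨ ∑-cong (suc i) (λ r → sym (*-assoc (inv r) (b i r k₁) (cc r j k₂))) ⟩
  productSum inv inv-! k₁ k₂ (suc i) i j
    ≈⟨ productSum-binomTerm inv inv-! k₁ k₂ i (ℕₚ.n<1+n i) j ⟩
  binom i j * (k₁ - k₂) ^ (i ∸ j) ∎
  where
  open CommutativeRing R
  open Notions R
  open Development R
  open import Relation.Binary.Reasoning.Setoid setoid
  below-j : ∀ r → r < j → inv r * (b i r k₁ * cc r j k₂) ≈ 0#
  below-j r r<j = trans (*-congˡ (trans (*-congˡ (cc-vanishing k₂ r<j)) (zeroʳ (b i r k₁)))) (zeroʳ (inv r))
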